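{- Let $q$ be a prime with $q\equiv 3\pmod 4$ and $S=\{2,q\}$. Suppose the system $ab+1=2q^{\beta_1}$, $ac+1=2^{\alpha_2}$, $ad+1=2^{\alpha_3}q^{\beta_3}$, $bc+1=2^{\alpha_4}q^{\beta_4}$, $bd+1=2^{\alpha_5}$, $cd+1=2q^{\beta_6}$ has no solution in positive integers $a,b,c,d$ and integers $\alpha_2,\alpha_3,\alpha_4,\alpha_5\ge 2$, $\beta_1,\beta_6\ge 1$, $\beta_3,\beta_4\ge 0$. Then there exists no $S$-Diophantine quadruple.
   Context: For a finite set $S$ of primes, a positive integer is an $S$-unit if all its prime factors lie in $S$. A quadruple $(a,b,c,d)$ of positive, pairwise distinct integers is an $S$-Diophantine quadruple if the product of any two distinct entries plus $1$ is an $S$-unit. -}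

module Defs where

open import Data.Nat using (ℕ; _+_; _*_; _^_; _≤_; _<_; _%_)
open import Data.Nat.Divisibility using (_∣_)
open import Data.Nat.Primality using (Prime)
open import Data.Product using (_×_; ∃-syntax)
open import Data.Sum using (_⊎_)
open import Relation.Binary.PropositionalEquality using (_≡_; _≢_)

IsSUnit : ℕ → ℕ → Set
IsSUnit q n = 0 < n × (∀ p → Prime p → p ∣ n → p ≡ 2 ⊎ p ≡ q)

IsSDiophantineQuadruple : ℕ → ℕ → ℕ → ℕ → ℕ → Set
IsSDiophantineQuadruple q a b c d =
  (0 < a × 0 < b × 0 < c × 0 < d) ×
  (a ≢ b × a ≢ c × a ≢ d × b ≢ c × b ≢ d × c ≢ d) ×
  (IsSUnit q (a * b + 1) × IsSUnit q (a * c + 1) × IsSUnit q (a * d + 1) ×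
   IsSUnit q (b * c + 1) × IsSUnit q (b * d + 1) × IsSUnit q (c * d + 1))

SystemSolvable : ℕ → Set
SystemSolvable q =
  ∃[ a ] ∃[ b ] ∃[ c ] ∃[ d ]
  ∃[ α₂ ] ∃[ α₃ ] ∃[ α₄ ] ∃[ α₅ ] ∃[ β₁ ] ∃[ β₃ ] ∃[ β₄ ] ∃[ β₆ ]
    (0 < a × 0 < b × 0 < c × 0 < d) ×
    (2 ≤ α₂ × 2 ≤ α₃ × 2 ≤ α₄ × 2 ≤ α₅ × 1 ≤ β₁ × 1 ≤ β₆) ×
    (a * b + 1 ≡ 2 * q ^ β₁ ×
     a * c + 1 ≡ 2 ^ α₂ ×
     a * d + 1 ≡ 2 ^ α₃ * q ^ β₃ ×
     b * c + 1 ≡ 2 ^ α₄ * q ^ β₄ ×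
     b * d + 1 ≡ 2 ^ α₅ ×
     c * d + 1 ≡ 2 * q ^ β₆)

{-# OPTIONS --safe #-}

-- Call a pair of entries of the quadruple an edge if q divides their product plus one.
-- Since q ≡ 3 (mod 4), −1 is not a square modulo q (by Fermat, x² ≡ −1 would give
-- x^(q−1) ≡ (−1)^((q−1)/2) = −1), and three pairwise edges x y, x z, y z would force
-- x² ≡ −1; so the edges form a triangle-free graph. Writing x y + 1 = 2^α q^β and
-- reducing modulo 4: an even entry is joined to every other entry, two odd entries with
-- equal residues are joined with α = 1, and two with distinct residues have α ≥ 2.
-- Triangle-freeness thus leaves four odd entries split two and two by residue, and the
-- entries can be ordered so that a c + 1 and b d + 1 are non-edges, i.e. powers of 2.

module Submission where

open import Defs
open import Data.Nat using (ℕ; _%_)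
open import Data.Nat.Primality using (Prime)
open import Data.Product using (∃-syntax)
open import Relation.Binary.PropositionalEquality using (_≡_)
open import Relation.Nullary using (¬_)

open import Data.Empty using (⊥; ⊥-elim)
open import Data.Fin.Base using (Fin; toℕ; fromℕ; inject₁; punchIn) renaming (suc to fsuc)
open import Data.Fin.Patterns using (0F; 1F; 2F; 3F)
open import Data.Fin.Properties using (inject₁ℕ<; toℕ-fromℕ; punchInᵢ≢i; punchIn-injective)
open import Data.List.Base using ([]; _∷_)
open import Data.List.Relation.Unary.All using (All; []; _∷_)
open import Data.Nat.Base
open import Data.Nat.Combinatorics using (_C_; nCk≡n!/k![n-k]!; k![n∸k]!∣n!; nCn≡1)
open import Data.Nat.DivMod using (m/n*n≡m; m≡m%n+[m/n]*n; m%n<n; %-distribˡ-+; %-distribˡ-*; m*n%n≡0)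
open import Data.Nat.Divisibility
open import Data.Nat.ListAction using (product)
open import Data.Nat.Primality using (euclidsLemma; prime⇒nonZero; prime⇒nonTrivial)
open import Data.Nat.Primality.Factorisation using (factorise; PrimeFactorisation)
open import Data.Nat.Properties
open import Data.Nat.Tactic.RingSolver using (solve-∀)
open import Data.Product using (_×_; _,_; proj₁; proj₂)
open import Data.Sum using (_⊎_; inj₁; inj₂; [_,_]′)
open import Data.Vec.Functional using (Vector; head; init; last; tail)
open import Function using (id; _∘_)
open import Relation.Binary.PropositionalEquality
  using (_≢_; refl; sym; trans; cong; cong₂; subst; subst₂; ≢-sym; module ≡-Reasoning)
open import Relation.Nullary using (yes; no; contradiction)
open import Algebra.Definitions.RawSemiring +-*-rawSemiring using (sum) renaming (_×_ to _×ᴿ_; _^_ to _^ᴿ_)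
open import Algebra.Properties.Monoid.Sum +-0-monoid using (sum-init-last)
import Algebra.Properties.CommutativeSemiring.Binomial +-*-commutativeSemiring as Binomial

-- Fermat's little theorem

prime⇒1<p : ∀ {p} → Prime p → 1 < p
prime⇒1<p {p} p-prime = nonTrivial⇒n>1 p {{prime⇒nonTrivial p-prime}}

prime∣n!⇒p≤n : ∀ {p} n → Prime p → p ∣ n ! → p ≤ n
prime∣n!⇒p≤n zero    p-prime p∣1  = contradiction (∣1⇒≡1 p∣1) (>⇒≢ (prime⇒1<p p-prime))
prime∣n!⇒p≤n (suc n) p-prime p∣n! =
  [ ∣⇒≤ , m≤n⇒m≤1+n ∘ prime∣n!⇒p≤n n p-prime ]′ (euclidsLemma (suc n) (n !) p-prime p∣n!)

n∣n! : ∀ n .{{_ : NonZero n}} → n ∣ n !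
n∣n! (suc n) = m∣m*n (n !)

nCk*k!*[n∸k]!≡n! : ∀ {n k} → k ≤ n → (n C k) * (k ! * (n ∸ k) !) ≡ n !
nCk*k!*[n∸k]!≡n! {n} {k} k≤n = begin
  (n C k) * (k ! * (n ∸ k) !)                   ≡⟨ cong (_* (k ! * (n ∸ k) !)) (nCk≡n!/k![n-k]! k≤n) ⟩
  (n ! / (k ! * (n ∸ k) !)) * (k ! * (n ∸ k) !) ≡⟨ m/n*n≡m (k![n∸k]!∣n! k≤n) ⟩
  n !                                           ∎
  where
  open ≡-Reasoning
  instance _ = k !* (n ∸ k) !≢0

prime∣pCk : ∀ {p k} → Prime p → 0 < k → k < p → p ∣ p C k
prime∣pCk {p} {k} p-prime 0<k k<p =
  [ id , ⊥-elim ∘ p∤k!*[p∸k]! ]′ (euclidsLemma (p C k) (k ! * (p ∸ k) !) p-prime p∣pCk*k!*[p∸k]!)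
  where
  instance _ = prime⇒nonZero p-prime
  p∣pCk*k!*[p∸k]! : p ∣ (p C k) * (k ! * (p ∸ k) !)
  p∣pCk*k!*[p∸k]! = subst (p ∣_) (sym (nCk*k!*[n∸k]!≡n! (<⇒≤ k<p))) (n∣n! p)
  p∤k!*[p∸k]! : ¬ p ∣ k ! * (p ∸ k) !
  p∤k!*[p∸k]! p∣ = [ <⇒≱ k<p ∘ prime∣n!⇒p≤n k p-prime
                   , <⇒≱ (∸-monoʳ-< 0<k (<⇒≤ k<p)) ∘ prime∣n!⇒p≤n (p ∸ k) p-prime
                   ]′ (euclidsLemma (k !) ((p ∸ k) !) p-prime p∣)

^ᴿ≡^ : ∀ x n → x ^ᴿ n ≡ x ^ n
^ᴿ≡^ x zero    = refl
^ᴿ≡^ x (suc n) = cong (x *_) (^ᴿ≡^ x n)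

×ᴿ≡* : ∀ m x → m ×ᴿ x ≡ m * x
×ᴿ≡* zero    x = refl
×ᴿ≡* (suc m) x = cong (x +_) (×ᴿ≡* m x)

∣m⇒∣m×ᴿn : ∀ {d m} n → d ∣ m → d ∣ m ×ᴿ n
∣m⇒∣m×ᴿn {m = m} n d∣m = subst (_ ∣_) (sym (×ᴿ≡* m n)) (∣m⇒∣m*n n d∣m)

∣-sum : ∀ {d n} (t : Vector ℕ n) → (∀ i → d ∣ t i) → d ∣ sum t
∣-sum {n = zero}  t d∣t = _ ∣0
∣-sum {n = suc n} t d∣t = ∣m∣n⇒∣m+n (d∣t _) (∣-sum (tail t) (d∣t ∘ fsuc))

freshman's-dream : ∀ {p} → Prime p → ∀ x → ∃[ r ] (x + 1) ^ p ≡ x ^ p + 1 + r * p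
freshman's-dream {suc n} p-prime x = r , (begin
  (x + 1) ^ p                                     ≡⟨ sym (^ᴿ≡^ (x + 1) p) ⟩
  (x + 1) ^ᴿ p                                    ≡⟨ Binomial.theorem p x 1 ⟩
  head t + sum (tail t)                           ≡⟨ cong (head t +_) (sum-init-last (tail t)) ⟩
  head t + (sum (init (tail t)) + last (tail t))
    ≡⟨ cong₂ _+_ first-term (cong₂ _+_ (m∣n⇒n≡quotient*m p∣middle) last-term) ⟩
  1 + (r * p + x ^ p)                             ≡⟨ regroup (r * p) (x ^ p) ⟩
  x ^ p + 1 + r * p                               ∎)
  where
  open ≡-Reasoning
  p = suc n
  t : Vector ℕ (suc p)
  t = Binomial.binomialTerm x 1 p
  p∣middle : p ∣ sum (init (tail t))
  p∣middle = ∣-sum (init (tail t)) λ i →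
    ∣m⇒∣m×ᴿn (Binomial.binomial x 1 p (fsuc (inject₁ i))) (prime∣pCk p-prime z<s (s<s (inject₁ℕ< i)))
  r : ℕ
  r = quotient p∣middle
  first-term : head t ≡ 1
  first-term = trans (+-identityʳ _) (trans (*-identityˡ _) (trans (^ᴿ≡^ 1 p) (^-zeroˡ p)))
  last-term : last (tail t) ≡ x ^ p
  last-term = begin
    last (tail t)
      ≡⟨ cong (λ k → (p C suc k) ×ᴿ (x ^ᴿ suc k * 1 ^ᴿ (n ∸ k))) (toℕ-fromℕ n) ⟩
    (p C p) ×ᴿ (x ^ᴿ p * 1 ^ᴿ (n ∸ n))
      ≡⟨ cong₂ (λ c e → c ×ᴿ (x ^ᴿ p * 1 ^ᴿ e)) (nCn≡1 p) (n∸n≡0 n) ⟩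
    x ^ᴿ p * 1 + 0                     ≡⟨ trans (+-identityʳ _) (*-identityʳ _) ⟩
    x ^ᴿ p                             ≡⟨ ^ᴿ≡^ x p ⟩
    x ^ p                              ∎
  regroup : ∀ a b → 1 + (a + b) ≡ b + 1 + a
  regroup = solve-∀

fermat : ∀ {p} → Prime p → ∀ x → ∃[ r ] x ^ p ≡ x + r * p
fermat {suc n} p-prime zero = 0 , refl
fermat {p} p-prime (suc x) with fermat p-prime x | freshman's-dream p-prime x
... | r , x^p≡x+rp | s , [x+1]^p≡x^p+1+sp = r + s , (begin
  suc x ^ p              ≡⟨ cong (_^ p) (+-comm 1 x) ⟩
  (x + 1) ^ p            ≡⟨ [x+1]^p≡x^p+1+sp ⟩
  x ^ p + 1 + s * p      ≡⟨ cong (λ y → y + 1 + s * p) x^p≡x+rp ⟩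
  x + r * p + 1 + s * p  ≡⟨ regroup x r s p ⟩
  suc x + (r + s) * p    ∎)
  where
  open ≡-Reasoning
  regroup : ∀ x r s p → x + r * p + 1 + s * p ≡ suc x + (r + s) * p
  regroup = solve-∀

-- −1 is not a square modulo a prime q ≡ 3 (mod 4)

∣y+1⇒∣y^odd+1 : ∀ {d y} → d ∣ y + 1 → ∀ j → d ∣ y ^ suc (j * 2) + 1
∣y+1⇒∣y^odd+1 {d} {y} d∣y+1 zero    = subst (λ z → d ∣ z + 1) (sym (*-identityʳ y)) d∣y+1
∣y+1⇒∣y^odd+1 {d} {y} d∣y+1 (suc j) =
  ∣m+n∣m⇒∣n (subst (d ∣_) (regroup y z) d∣sum) (∣n⇒∣m*n y d∣y+1)
  where
  z = y ^ suc (j * 2)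
  d∣sum : d ∣ y * y * (z + 1) + (y + 1)
  d∣sum = ∣m∣n⇒∣m+n (∣n⇒∣m*n (y * y) (∣y+1⇒∣y^odd+1 d∣y+1 j)) d∣y+1
  regroup : ∀ y z → y * y * (z + 1) + (y + 1) ≡ y * (y + 1) + (y * (y * z) + 1)
  regroup = solve-∀

∣x*x+1⇒∣2*x : ∀ {q} m → Prime q → q ≡ 3 + m * 4 → ∀ x → q ∣ x * x + 1 → q ∣ 2 * x
∣x*x+1⇒∣2*x {q} m q-prime refl x q∣x²+1 with fermat q-prime x
... | r , x^q≡x+rq = ∣m+n∣m⇒∣n (subst (q ∣_) x[x²ᵉ+1]≡rq+2x (∣n⇒∣m*n x q∣x²ᵉ+1)) (n∣m*n r)
  where
  open ≡-Reasoning
  e = suc (m * 2)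
  q∣x²ᵉ+1 : q ∣ (x * x) ^ e + 1
  q∣x²ᵉ+1 = ∣y+1⇒∣y^odd+1 q∣x²+1 m
  x^q≡x*x²ᵉ : x ^ q ≡ x * (x * x) ^ e
  x^q≡x*x²ᵉ = begin
    x ^ q                  ≡⟨ cong (x ^_) (exponent m) ⟩
    x * x ^ (2 * e)        ≡⟨ cong (x *_) (sym (^-*-assoc x 2 e)) ⟩
    x * (x * (x * 1)) ^ e  ≡⟨ cong (λ y → x * (x * y) ^ e) (*-identityʳ x) ⟩
    x * (x * x) ^ e        ∎
    where
    exponent : ∀ m → 3 + m * 4 ≡ suc (2 * suc (m * 2))
    exponent = solve-∀
  x[x²ᵉ+1]≡rq+2x : x * ((x * x) ^ e + 1) ≡ r * q + 2 * x
  x[x²ᵉ+1]≡rq+2x = begin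
    x * ((x * x) ^ e + 1)    ≡⟨ *-distribˡ-+ x _ 1 ⟩
    x * (x * x) ^ e + x * 1  ≡⟨ cong₂ _+_ (sym x^q≡x*x²ᵉ) (*-identityʳ x) ⟩
    x ^ q + x                ≡⟨ cong (_+ x) x^q≡x+rq ⟩
    x + r * q + x            ≡⟨ regroup x (r * q) ⟩
    r * q + 2 * x            ∎
    where
    regroup : ∀ a b → a + b + a ≡ b + 2 * a
    regroup = solve-∀

prime≡3[mod4]⇒∤x*x+1 : ∀ {q} → Prime q → q % 4 ≡ 3 → ∀ x → ¬ q ∣ x * x + 1
prime≡3[mod4]⇒∤x*x+1 {q} q-prime q%4≡3 x q∣x²+1 =
  [ q∤2 , q∤x ]′ (euclidsLemma 2 x q-prime (∣x*x+1⇒∣2*x (q / 4) q-prime q≡3+4m x q∣x²+1))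
  where
  q≡3+4m : q ≡ 3 + q / 4 * 4
  q≡3+4m = trans (m≡m%n+[m/n]*n q 4) (cong (_+ q / 4 * 4) q%4≡3)
  q∤2 : ¬ q ∣ 2
  q∤2 q∣2 = <⇒≱ (subst (3 ≤_) (sym q≡3+4m) (m≤m+n 3 _)) (∣⇒≤ q∣2)
  q∤x : ¬ q ∣ x
  q∤x q∣x = >⇒≢ (prime⇒1<p q-prime) (∣1⇒≡1 (∣m+n∣m⇒∣n q∣x²+1 (∣m⇒∣m*n x q∣x)))

no-triangle : ∀ {q x y z} → Prime q → q % 4 ≡ 3 →
              q ∣ x * y + 1 → q ∣ x * z + 1 → q ∣ y * z + 1 → ⊥
no-triangle {q} {x} {y} {z} q-prime q%4≡3 q∣xy+1 q∣xz+1 q∣yz+1 =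
  prime≡3[mod4]⇒∤x*x+1 q-prime q%4≡3 x
    (∣m+n∣m⇒∣n (subst (q ∣_) (sym (identity x y z)) q∣sum) (∣n⇒∣m*n x (∣m⇒∣m*n z q∣xy+1)))
  where
  q∣sum : q ∣ (x * z + 1) + x * ((y * z + 1) * x)
  q∣sum = ∣m∣n⇒∣m+n q∣xz+1 (∣n⇒∣m*n x (∣m⇒∣m*n x q∣yz+1))
  identity : ∀ x y z → x * ((x * y + 1) * z) + (x * x + 1) ≡ (x * z + 1) + x * ((y * z + 1) * x)
  identity = solve-∀

-- Residues modulo 4

data Even (n : ℕ) : Set where
  even₀ : n % 4 ≡ 0 → Even n
  even₂ : n % 4 ≡ 2 → Even n

data Odd (n : ℕ) : Set where
  odd₁ : n % 4 ≡ 1 → Odd n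
  odd₃ : n % 4 ≡ 3 → Odd n

even-or-odd : ∀ n → Even n ⊎ Odd n
even-or-odd n = by-residue (n % 4) refl (m%n<n n 4)
  where
  by-residue : ∀ r → n % 4 ≡ r → r < 4 → Even n ⊎ Odd n
  by-residue 0 n%4≡0 _ = inj₁ (even₀ n%4≡0)
  by-residue 1 n%4≡1 _ = inj₂ (odd₁ n%4≡1)
  by-residue 2 n%4≡2 _ = inj₁ (even₂ n%4≡2)
  by-residue 3 n%4≡3 _ = inj₂ (odd₃ n%4≡3)
  by-residue (suc (suc (suc (suc _)))) _ (s≤s (s≤s (s≤s (s≤s ()))))

odd⇒¬even : ∀ {n} → Odd n → ¬ Even n
odd⇒¬even (odd₁ ≡1) (even₀ ≡0) with trans (sym ≡1) ≡0
... | ()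
odd⇒¬even (odd₁ ≡1) (even₂ ≡2) with trans (sym ≡1) ≡2
... | ()
odd⇒¬even (odd₃ ≡3) (even₀ ≡0) with trans (sym ≡3) ≡0
... | ()
odd⇒¬even (odd₃ ≡3) (even₂ ≡2) with trans (sym ≡3) ≡2
... | ()

*-%4 : ∀ x y {r s} → x % 4 ≡ r → y % 4 ≡ s → (x * y) % 4 ≡ (r * s) % 4
*-%4 x y refl refl = %-distribˡ-* x y 4

*+1-%4 : ∀ x y {r s} → x % 4 ≡ r → y % 4 ≡ s → (x * y + 1) % 4 ≡ (r * s + 1) % 4
*+1-%4 x y {r} {s} x%4≡r y%4≡s = begin
  (x * y + 1) % 4        ≡⟨ %-distribˡ-+ (x * y) 1 4 ⟩
  ((x * y) % 4 + 1) % 4  ≡⟨ cong (λ m → (m + 1) % 4) (*-%4 x y x%4≡r y%4≡s) ⟩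
  ((r * s) % 4 + 1) % 4  ≡⟨ %-distribˡ-+ (r * s) 1 4 ⟨
  (r * s + 1) % 4        ∎
  where open ≡-Reasoning

odd*odd : ∀ {x y} → Odd x → Odd y → Odd (x * y)
odd*odd {x} {y} (odd₁ x≡1) (odd₁ y≡1) = odd₁ (*-%4 x y x≡1 y≡1)
odd*odd {x} {y} (odd₁ x≡1) (odd₃ y≡3) = odd₃ (*-%4 x y x≡1 y≡3)
odd*odd {x} {y} (odd₃ x≡3) (odd₁ y≡1) = odd₃ (*-%4 x y x≡3 y≡1)
odd*odd {x} {y} (odd₃ x≡3) (odd₃ y≡3) = odd₁ (*-%4 x y x≡3 y≡3)

odd^n : ∀ {x} → Odd x → ∀ n → Odd (x ^ n)
odd^n x-odd zero    = odd₁ refl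
odd^n x-odd (suc n) = odd*odd x-odd (odd^n x-odd n)

even⇒odd-*+1 : ∀ {x} → Even x → ∀ y → Odd (x * y + 1)
even⇒odd-*+1 {x} (even₀ x≡0) y = odd₁ (*+1-%4 x y x≡0 refl)
even⇒odd-*+1 {x} (even₂ x≡2) y with even-or-odd y
... | inj₁ (even₀ y≡0) = odd₁ (*+1-%4 x y x≡2 y≡0)
... | inj₁ (even₂ y≡2) = odd₁ (*+1-%4 x y x≡2 y≡2)
... | inj₂ (odd₁ y≡1)  = odd₃ (*+1-%4 x y x≡2 y≡1)
... | inj₂ (odd₃ y≡3)  = odd₃ (*+1-%4 x y x≡2 y≡3)

equal-odd-residues⇒*+1%4≡2 : ∀ {x y} → Odd x → x % 4 ≡ y % 4 → (x * y + 1) % 4 ≡ 2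
equal-odd-residues⇒*+1%4≡2 {x} {y} (odd₁ x≡1) x≡y = *+1-%4 x y x≡1 (trans (sym x≡y) x≡1)
equal-odd-residues⇒*+1%4≡2 {x} {y} (odd₃ x≡3) x≡y = *+1-%4 x y x≡3 (trans (sym x≡y) x≡3)

distinct-odd-residues⇒*+1%4≡0 : ∀ {x y} → Odd x → Odd y → x % 4 ≢ y % 4 → (x * y + 1) % 4 ≡ 0
distinct-odd-residues⇒*+1%4≡0 {x} {y} (odd₁ x≡1) (odd₃ y≡3) _   = *+1-%4 x y x≡1 y≡3
distinct-odd-residues⇒*+1%4≡0 {x} {y} (odd₃ x≡3) (odd₁ y≡1) _   = *+1-%4 x y x≡3 y≡1
distinct-odd-residues⇒*+1%4≡0         (odd₁ x≡1) (odd₁ y≡1) x≢y = contradiction (trans x≡1 (sym y≡1)) x≢y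
distinct-odd-residues⇒*+1%4≡0         (odd₃ x≡3) (odd₃ y≡3) x≢y = contradiction (trans x≡3 (sym y≡3)) x≢y

odd-residues-pigeonhole : ∀ {x y z} → Odd x → Odd y → Odd z →
                          x % 4 ≢ y % 4 → x % 4 ≢ z % 4 → y % 4 ≡ z % 4
odd-residues-pigeonhole (odd₁ x≡1) (odd₁ y≡1) _ x≢y _ = contradiction (trans x≡1 (sym y≡1)) x≢y
odd-residues-pigeonhole (odd₃ x≡3) (odd₃ y≡3) _ x≢y _ = contradiction (trans x≡3 (sym y≡3)) x≢y
odd-residues-pigeonhole (odd₁ x≡1) _ (odd₁ z≡1) _ x≢z = contradiction (trans x≡1 (sym z≡1)) x≢z
odd-residues-pigeonhole (odd₃ x≡3) _ (odd₃ z≡3) _ x≢z = contradiction (trans x≡3 (sym z≡3)) x≢z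
odd-residues-pigeonhole (odd₁ _) (odd₃ y≡3) (odd₃ z≡3) _ _ = trans y≡3 (sym z≡3)
odd-residues-pigeonhole (odd₃ _) (odd₁ y≡1) (odd₁ z≡1) _ _ = trans y≡1 (sym z≡1)

2^[2+α]*u%4≡0 : ∀ α u → (2 ^ (2 + α) * u) % 4 ≡ 0
2^[2+α]*u%4≡0 α u = trans (cong (_% 4) (regroup (2 ^ α) u)) (m*n%n≡0 (2 ^ α * u) 4)
  where
  regroup : ∀ t u → 2 * (2 * t) * u ≡ t * u * 4
  regroup = solve-∀

odd⇒2*u%4≡2 : ∀ {u} → Odd u → (2 * u) % 4 ≡ 2
odd⇒2*u%4≡2 {u} (odd₁ u≡1) = *-%4 2 u refl u≡1
odd⇒2*u%4≡2 {u} (odd₃ u≡3) = *-%4 2 u refl u≡3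

odd⇒1*u-odd : ∀ {u} → Odd u → Odd (1 * u)
odd⇒1*u-odd {u} = subst Odd (sym (*-identityˡ u))

odd-2^α*odd⇒α≡0 : ∀ {α u} → Odd u → Odd (2 ^ α * u) → α ≡ 0
odd-2^α*odd⇒α≡0 {zero}            _     _   = refl
odd-2^α*odd⇒α≡0 {1}               u-odd odd = contradiction (even₂ (odd⇒2*u%4≡2 u-odd)) (odd⇒¬even odd)
odd-2^α*odd⇒α≡0 {suc (suc α)} {u} _     odd = contradiction (even₀ (2^[2+α]*u%4≡0 α u)) (odd⇒¬even odd)

2^α*odd%4≡2⇒α≡1 : ∀ {α u} → Odd u → (2 ^ α * u) % 4 ≡ 2 → α ≡ 1
2^α*odd%4≡2⇒α≡1 {zero}            u-odd ≡2 = contradiction (even₂ ≡2) (odd⇒¬even (odd⇒1*u-odd u-odd))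
2^α*odd%4≡2⇒α≡1 {1}               _     _  = refl
2^α*odd%4≡2⇒α≡1 {suc (suc α)} {u} _     ≡2 with trans (sym ≡2) (2^[2+α]*u%4≡0 α u)
... | ()

2^α*odd%4≡0⇒2≤α : ∀ {α u} → Odd u → (2 ^ α * u) % 4 ≡ 0 → 2 ≤ α
2^α*odd%4≡0⇒2≤α {zero}        u-odd ≡0 = contradiction (even₀ ≡0) (odd⇒¬even (odd⇒1*u-odd u-odd))
2^α*odd%4≡0⇒2≤α {1}           u-odd ≡0 with trans (sym ≡0) (odd⇒2*u%4≡2 u-odd)
... | ()
2^α*odd%4≡0⇒2≤α {suc (suc α)} _     _  = s≤s (s≤s z≤n)

-- An even entry makes x y + 1 odd, and equal odd residues make it ≡ 2 (mod 4);
-- either way an S-unit x y + 1 with x ≠ y must be divisible by q.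
Forced : ℕ → ℕ → Set
Forced x y = Even x ⊎ Even y ⊎ x % 4 ≡ y % 4

forced-among-three : ∀ x y z → Forced x y ⊎ Forced x z ⊎ Forced y z
forced-among-three x y z with even-or-odd x | even-or-odd y | even-or-odd z
... | inj₁ x-even | _           | _           = inj₁ (inj₁ x-even)
... | _           | inj₁ y-even | _           = inj₁ (inj₂ (inj₁ y-even))
... | _           | _           | inj₁ z-even = inj₂ (inj₁ (inj₂ (inj₁ z-even)))
... | inj₂ x-odd  | inj₂ y-odd  | inj₂ z-odd  with x % 4 ≟ y % 4 | x % 4 ≟ z % 4
...   | yes x≡y | _       = inj₁ (inj₂ (inj₂ x≡y))
...   | _       | yes x≡z = inj₂ (inj₁ (inj₂ (inj₂ x≡z)))
...   | no x≢y  | no x≢z  = inj₂ (inj₂ (inj₂ (inj₂ (odd-residues-pigeonhole x-odd y-odd z-odd x≢y x≢z))))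

-- S-units for S = {2, q}

∏⇒2^α*q^β : ∀ {q} ps → All Prime ps → (∀ p → Prime p → p ∣ product ps → p ≡ 2 ⊎ p ≡ q) →
            ∃[ α ] ∃[ β ] product ps ≡ 2 ^ α * q ^ β
∏⇒2^α*q^β [] _ _ = 0 , 0 , refl
∏⇒2^α*q^β {q} (p ∷ ps) (p-prime ∷ ps-prime) in-S
  with ∏⇒2^α*q^β ps ps-prime (λ p′ p′-prime p′∣ → in-S p′ p′-prime (∣n⇒∣m*n p p′∣))
     | in-S p p-prime (m∣m*n (product ps))
... | α , β , eq | inj₁ refl = suc α , β , trans (cong (2 *_) eq) (sym (*-assoc 2 (2 ^ α) (q ^ β)))
... | α , β , eq | inj₂ refl = α , suc β , trans (cong (q *_) eq) (regroup q (2 ^ α) (q ^ β))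
  where
  regroup : ∀ q a b → q * (a * b) ≡ a * (q * b)
  regroup = solve-∀

IsSUnit⇒2^α*q^β : ∀ {q n} → IsSUnit q n → ∃[ α ] ∃[ β ] n ≡ 2 ^ α * q ^ β
IsSUnit⇒2^α*q^β {q} {n} (0<n , in-S) =
  subst (λ m → ∃[ α ] ∃[ β ] m ≡ 2 ^ α * q ^ β) (sym isFactorisation)
    (∏⇒2^α*q^β factors factorsPrime λ p p-prime p∣∏ →
      in-S p p-prime (subst (p ∣_) (sym isFactorisation) p∣∏))
  where open PrimeFactorisation (factorise n {{>-nonZero 0<n}})

*+1-comm : ∀ {ℓ} (P : ℕ → Set ℓ) x y → P (x * y + 1) → P (y * x + 1)
*+1-comm P x y = subst (λ n → P (n + 1)) (*-comm x y)

*+1≢1 : ∀ {x y} → 0 < x → 0 < y → x * y + 1 ≢ 1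
*+1≢1 {suc x} {suc y} _ _ eq with +-cancelʳ-≡ 1 (suc x * suc y) 0 eq
... | ()

*+1≡2⇒≡ : ∀ {x y} → x * y + 1 ≡ 2 → x ≡ y
*+1≡2⇒≡ {x} {y} eq = trans (m*n≡1⇒m≡1 x y xy≡1) (sym (m*n≡1⇒n≡1 x y xy≡1))
  where
  xy≡1 : x * y ≡ 1
  xy≡1 = +-cancelʳ-≡ 1 (x * y) 1 eq

module _ {q : ℕ} (q%4≡3 : q % 4 ≡ 3) where

  q^β-odd : ∀ β → Odd (q ^ β)
  q^β-odd = odd^n (odd₃ q%4≡3)

  q∣2^α*q^[1+β] : ∀ α β → q ∣ 2 ^ α * q ^ suc β
  q∣2^α*q^[1+β] α β = ∣n⇒∣m*n (2 ^ α) (m∣m*n (q ^ β))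

  q∤2^α*q^β⇒≡2^α : ∀ {n} α β → ¬ q ∣ n → n ≡ 2 ^ α * q ^ β → n ≡ 2 ^ α
  q∤2^α*q^β⇒≡2^α α zero    _   eq = trans eq (*-identityʳ (2 ^ α))
  q∤2^α*q^β⇒≡2^α α (suc β) q∤n eq = contradiction (subst (q ∣_) (sym eq) (q∣2^α*q^[1+β] α β)) q∤n

  even⇒q∣*+1 : ∀ {x y} → 0 < x → 0 < y → Even x → IsSUnit q (x * y + 1) → q ∣ x * y + 1
  even⇒q∣*+1 {x} {y} 0<x 0<y x-even unit with IsSUnit⇒2^α*q^β unit
  ... | α , suc β , eq = subst (q ∣_) (sym eq) (q∣2^α*q^[1+β] α β)
  ... | α , zero  , eq with odd-2^α*odd⇒α≡0 {α} (q^β-odd 0) (subst Odd eq (even⇒odd-*+1 x-even y))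
  ...   | refl = contradiction eq (*+1≢1 0<x 0<y)

  equal-odd-residues⇒2*q^[1+β] : ∀ {x y} → x ≢ y → Odd x → x % 4 ≡ y % 4 → IsSUnit q (x * y + 1) →
                                 ∃[ β ] x * y + 1 ≡ 2 * q ^ suc β
  equal-odd-residues⇒2*q^[1+β] {x} {y} x≢y x-odd x≡y unit with IsSUnit⇒2^α*q^β unit
  ... | α , β , eq with 2^α*odd%4≡2⇒α≡1 {α} (q^β-odd β) (subst (λ n → n % 4 ≡ 2) eq ≡2)
    where ≡2 = equal-odd-residues⇒*+1%4≡2 x-odd x≡y
  ...   | refl with β
  ...     | suc β = β , eq
  ...     | zero  = contradiction (*+1≡2⇒≡ eq) x≢y

  distinct-odd-residues⇒2^α*q^β : ∀ {x y} → Odd x → Odd y → x % 4 ≢ y % 4 → IsSUnit q (x * y + 1) →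
                                  ∃[ α ] ∃[ β ] 2 ≤ α × x * y + 1 ≡ 2 ^ α * q ^ β
  distinct-odd-residues⇒2^α*q^β x-odd y-odd x≢y unit with IsSUnit⇒2^α*q^β unit
  ... | α , β , eq = α , β , 2^α*odd%4≡0⇒2≤α {α} (q^β-odd β) ≡0 , eq
    where ≡0 = subst (λ n → n % 4 ≡ 0) eq (distinct-odd-residues⇒*+1%4≡0 x-odd y-odd x≢y)

  forced⇒q∣*+1 : ∀ {x y} → 0 < x → 0 < y → x ≢ y → IsSUnit q (x * y + 1) → Forced x y → q ∣ x * y + 1
  forced⇒q∣*+1 0<x 0<y _ unit (inj₁ x-even) = even⇒q∣*+1 0<x 0<y x-even unit
  forced⇒q∣*+1 {x} {y} 0<x 0<y _ unit (inj₂ (inj₁ y-even)) =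
    *+1-comm (q ∣_) y x (even⇒q∣*+1 0<y 0<x y-even (*+1-comm (IsSUnit q) x y unit))
  forced⇒q∣*+1 {x} 0<x 0<y x≢y unit (inj₂ (inj₂ x≡y)) with even-or-odd x
  ... | inj₁ x-even = even⇒q∣*+1 0<x 0<y x-even unit
  ... | inj₂ x-odd with equal-odd-residues⇒2*q^[1+β] x≢y x-odd x≡y unit
  ...   | β , eq = subst (q ∣_) (sym eq) (q∣2^α*q^[1+β] 1 β)

-- The quadruple indexed by Fin 4, so that the argument below can permute its entries freely.
record IndexedQuadruple (q : ℕ) : Set where
  field
    entry    : Fin 4 → ℕ
    positive : ∀ i → 0 < entry i
    pair     : ∀ {i j} → i ≢ j → entry i ≢ entry j × IsSUnit q (entry i * entry j + 1)

index : ∀ {q a b c d} → IsSDiophantineQuadruple q a b c d → IndexedQuadruple q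
index {q} {a} {b} {c} {d}
  ((0<a , 0<b , 0<c , 0<d) , (a≢b , a≢c , a≢d , b≢c , b≢d , c≢d) , (ab , ac , ad , bc , bd , cd)) =
  record { entry = entry ; positive = positive ; pair = pair }
  where
  entry : Fin 4 → ℕ
  entry 0F = a
  entry 1F = b
  entry 2F = c
  entry 3F = d
  positive : ∀ i → 0 < entry i
  positive 0F = 0<a
  positive 1F = 0<b
  positive 2F = 0<c
  positive 3F = 0<d
  swap : ∀ {x y} → x ≢ y × IsSUnit q (x * y + 1) → y ≢ x × IsSUnit q (y * x + 1)
  swap {x} {y} (x≢y , unit) = ≢-sym x≢y , *+1-comm (IsSUnit q) x y unit
  pair : ∀ {i j} → i ≢ j → entry i ≢ entry j × IsSUnit q (entry i * entry j + 1)
  pair {0F} {1F} _ = a≢b , ab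
  pair {0F} {2F} _ = a≢c , ac
  pair {0F} {3F} _ = a≢d , ad
  pair {1F} {2F} _ = b≢c , bc
  pair {1F} {3F} _ = b≢d , bd
  pair {2F} {3F} _ = c≢d , cd
  pair {1F} {0F} _ = swap (a≢b , ab)
  pair {2F} {0F} _ = swap (a≢c , ac)
  pair {3F} {0F} _ = swap (a≢d , ad)
  pair {2F} {1F} _ = swap (b≢c , bc)
  pair {3F} {1F} _ = swap (b≢d , bd)
  pair {3F} {2F} _ = swap (c≢d , cd)
  pair {0F} {0F} 0≢0 = contradiction refl 0≢0
  pair {1F} {1F} 1≢1 = contradiction refl 1≢1
  pair {2F} {2F} 2≢2 = contradiction refl 2≢2
  pair {3F} {3F} 3≢3 = contradiction refl 3≢3

module _ {q : ℕ} (q-prime : Prime q) (q%4≡3 : q % 4 ≡ 3) (quad : IndexedQuadruple q) where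

  open IndexedQuadruple quad

  Edge : Fin 4 → Fin 4 → Set
  Edge i j = q ∣ entry i * entry j + 1

  residue : Fin 4 → ℕ
  residue i = entry i % 4

  forced-edge : ∀ {i j} → i ≢ j → Forced (entry i) (entry j) → Edge i j
  forced-edge {i} {j} i≢j =
    forced⇒q∣*+1 q%4≡3 (positive i) (positive j) (proj₁ (pair i≢j)) (proj₂ (pair i≢j))

  equal-residue-edge : ∀ {i j} → i ≢ j → residue i ≡ residue j → Edge i j
  equal-residue-edge i≢j = forced-edge i≢j ∘ inj₂ ∘ inj₂

  triangle-free : ∀ {i j k} → Edge i j → Edge i k → Edge j k → ⊥
  triangle-free {i} {j} {k} = no-triangle {x = entry i} {entry j} {entry k} q-prime q%4≡3

  equal-residue-triangle : ∀ {i j k} → i ≢ j → i ≢ k → j ≢ k →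
                           residue i ≡ residue j → residue i ≡ residue k → ⊥
  equal-residue-triangle i≢j i≢k j≢k i≡j i≡k = triangle-free
    (equal-residue-edge i≢j i≡j) (equal-residue-edge i≢k i≡k) (equal-residue-edge j≢k (trans (sym i≡j) i≡k))

  no-even-entry : ∀ i → ¬ Even (entry i)
  no-even-entry i i-even =
    [ no-forced-pair 0F 1F (λ ()) , [ no-forced-pair 0F 2F (λ ()) , no-forced-pair 1F 2F (λ ()) ]′ ]′
      (forced-among-three (entry (punchIn i 0F)) (entry (punchIn i 1F)) (entry (punchIn i 2F)))
    where
    hub : ∀ s → Edge i (punchIn i s)
    hub s = forced-edge (punchInᵢ≢i i s ∘ sym) (inj₁ i-even)
    no-forced-pair : ∀ s t → s ≢ t → ¬ Forced (entry (punchIn i s)) (entry (punchIn i t))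
    no-forced-pair s t s≢t = triangle-free (hub s) (hub t) ∘ forced-edge (s≢t ∘ punchIn-injective i s t)

  all-odd : ∀ i → Odd (entry i)
  all-odd i with even-or-odd (entry i)
  ... | inj₁ i-even = contradiction i-even (no-even-entry i)
  ... | inj₂ i-odd  = i-odd

  equal-residue-shape : ∀ {i j} → i ≢ j → residue i ≡ residue j →
                        ∃[ β ] entry i * entry j + 1 ≡ 2 * q ^ suc β
  equal-residue-shape {i} i≢j i≡j =
    equal-odd-residues⇒2*q^[1+β] q%4≡3 (proj₁ (pair i≢j)) (all-odd i) i≡j (proj₂ (pair i≢j))

  distinct-residue-shape : ∀ {i j} → residue i ≢ residue j →
                           ∃[ α ] ∃[ β ] 2 ≤ α × entry i * entry j + 1 ≡ 2 ^ α * q ^ β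
  distinct-residue-shape {i} {j} i≢j =
    distinct-odd-residues⇒2^α*q^β q%4≡3 (all-odd i) (all-odd j) i≢j (proj₂ (pair (i≢j ∘ cong residue)))

  non-edge-shape : ∀ {i j} → residue i ≢ residue j → ¬ Edge i j →
                   ∃[ α ] 2 ≤ α × entry i * entry j + 1 ≡ 2 ^ α
  non-edge-shape i≢j ¬edge with distinct-residue-shape i≢j
  ... | α , β , 2≤α , eq = α , 2≤α , q∤2^α*q^β⇒≡2^α q%4≡3 α β ¬edge eq

  system : ∀ {i j k l} → i ≢ j → k ≢ l →
           residue i ≡ residue j → residue k ≡ residue l → residue i ≢ residue k →
           ¬ Edge i k → ¬ Edge j l → SystemSolvable q
  system {i} {j} {k} {l} i≢j k≢l i≡j k≡l i≢k ¬ik ¬jl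
    with equal-residue-shape i≢j i≡j
       | non-edge-shape i≢k ¬ik
       | distinct-residue-shape (subst (residue i ≢_) k≡l i≢k)
       | distinct-residue-shape (subst (_≢ residue k) i≡j i≢k)
       | non-edge-shape (subst₂ _≢_ i≡j k≡l i≢k) ¬jl
       | equal-residue-shape k≢l k≡l
  ... | β₁ , e₁ | α₂ , 2≤α₂ , e₂ | α₃ , β₃ , 2≤α₃ , e₃
      | α₄ , β₄ , 2≤α₄ , e₄ | α₅ , 2≤α₅ , e₅ | β₆ , e₆ =
    entry i , entry j , entry k , entry l , α₂ , α₃ , α₄ , α₅ , suc β₁ , β₃ , β₄ , suc β₆ ,
    (positive i , positive j , positive k , positive l) ,
    (2≤α₂ , 2≤α₃ , 2≤α₄ , 2≤α₅ , s≤s z≤n , s≤s z≤n) ,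
    (e₁ , e₂ , e₃ , e₄ , e₅ , e₆)

  -- Two cross edges sharing an entry would close a triangle with the edge i j or k l,
  -- so one of the matchings {i k, j l} and {i l, j k} consists of non-edges.
  split⇒system : ∀ {i j k l} → i ≢ j → k ≢ l → residue i ≡ residue j → residue k ≡ residue l →
                 residue i ≢ residue k → SystemSolvable q
  split⇒system {i} {j} {k} {l} i≢j k≢l i≡j k≡l i≢k
    with q ∣? entry i * entry k + 1 | q ∣? entry j * entry l + 1
  ... | no ¬ik | no ¬jl = system i≢j k≢l i≡j k≡l i≢k ¬ik ¬jl
  ... | yes ik | _      =
    system i≢j (≢-sym k≢l) i≡j (sym k≡l) i≢l (λ il → triangle-free ik il kl) (triangle-free ij ik)
    where
    ij = equal-residue-edge i≢j i≡j
    kl = equal-residue-edge k≢l k≡l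
    i≢l = subst (residue i ≢_) k≡l i≢k
  ... | no _   | yes jl =
    system i≢j (≢-sym k≢l) i≡j (sym k≡l) i≢l (λ il → triangle-free ij il jl) (λ jk → triangle-free jk jl kl)
    where
    ij = equal-residue-edge i≢j i≡j
    kl = equal-residue-edge k≢l k≡l
    i≢l = subst (residue i ≢_) k≡l i≢k

  other-residues : ∀ {j k} → residue 0F ≢ residue j → residue 0F ≢ residue k → residue j ≡ residue k
  other-residues = odd-residues-pigeonhole (all-odd 0F) (all-odd _) (all-odd _)

  quadruple⇒system : SystemSolvable q
  quadruple⇒system with residue 0F ≟ residue 1F | residue 0F ≟ residue 2F | residue 0F ≟ residue 3F
  ... | yes ≡₁ | yes ≡₂ | _      = ⊥-elim (equal-residue-triangle {0F} {1F} {2F} (λ ()) (λ ()) (λ ()) ≡₁ ≡₂)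
  ... | yes ≡₁ | _      | yes ≡₃ = ⊥-elim (equal-residue-triangle {0F} {1F} {3F} (λ ()) (λ ()) (λ ()) ≡₁ ≡₃)
  ... | _      | yes ≡₂ | yes ≡₃ = ⊥-elim (equal-residue-triangle {0F} {2F} {3F} (λ ()) (λ ()) (λ ()) ≡₂ ≡₃)
  ... | no ≢₁  | no ≢₂  | no ≢₃  = ⊥-elim (equal-residue-triangle {1F} {2F} {3F} (λ ()) (λ ()) (λ ())
                                                                  (other-residues ≢₁ ≢₂) (other-residues ≢₁ ≢₃))
  ... | yes ≡₁ | no ≢₂  | no ≢₃  = split⇒system {0F} {1F} {2F} {3F} (λ ()) (λ ()) ≡₁ (other-residues ≢₂ ≢₃) ≢₂
  ... | no ≢₁  | yes ≡₂ | no ≢₃  = split⇒system {0F} {2F} {1F} {3F} (λ ()) (λ ()) ≡₂ (other-residues ≢₁ ≢₃) ≢₁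
  ... | no ≢₁  | no ≢₂  | yes ≡₃ = split⇒system {0F} {3F} {1F} {2F} (λ ()) (λ ()) ≡₃ (other-residues ≢₁ ≢₂) ≢₁

lemma6 : (q : ℕ) → Prime q → q % 4 ≡ 3 → ¬ SystemSolvable q →
    ¬ (∃[ a ] ∃[ b ] ∃[ c ] ∃[ d ] IsSDiophantineQuadruple q a b c d)
lemma6 q q-prime q%4≡3 unsolvable (a , b , c , d , quadruple) =
  unsolvable (quadruple⇒system q-prime q%4≡3 (index quadruple))
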